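{- Let $a,b \in \mathbb{Z}_{\ge 0}$. Then $\mathrm{ls}_\Sigma([0,a]\times[0,b]) = a+b$.
   Context: A unimodular transformation is an affine map $v \mapsto Av+w$ with $A \in \mathrm{GL}_2(\mathbb{Z})$ and $w \in \mathbb{Z}^2$. Let $\Sigma = \mathrm{conv}\{(0,0),(1,0),(0,1)\}$. For a non-empty lattice polygon $\Delta$, $\mathrm{ls}_\Sigma(\Delta)$ is the smallest integer $d \ge 0$ such that $\varphi(\Delta) \subset d\Sigma$ for some unimodular transformation $\varphi$.
   Formalization: The rectangle $[0,a]\times[0,b]$, the triangle $d\Sigma$ and the inclusion $\varphi(\Delta) \subset d\Sigma$ are taken over the points with rational coordinates. -}

module Defs where

open import Data.Nat using (ℕ)
open import Data.Integer as ℤ using (ℤ; +_; -[1+_])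
open import Data.Rational as ℚ using (ℚ; _≤_; _+_; _*_; 0ℚ)
open import Data.Product using (_×_; _,_; Σ; ∃)
open import Data.Sum using (_⊎_)
open import Relation.Binary.PropositionalEquality using (_≡_)

-- All polygons here are
-- lattice polygons (hence convex with rational vertices), so containment of
-- their rational points determines containment of the (closed) real polygons.
Point : Set
Point = ℚ × ℚ

Region : Set₁
Region = Point → Set

_⊆ᴿ_ : Region → Region → Set
P ⊆ᴿ Q = ∀ p → P p → Q p

record Unimodular : Set where
  field
    a₁₁ a₁₂ a₂₁ a₂₂ w₁ w₂ : ℤ
    det±1 : (a₁₁ ℤ.* a₂₂ ℤ.- a₁₂ ℤ.* a₂₁ ≡ + 1)
          ⊎ (a₁₁ ℤ.* a₂₂ ℤ.- a₁₂ ℤ.* a₂₁ ≡ -[1+ 0 ])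

open Unimodular public

ι : ℤ → ℚ
ι z = z ℚ./ 1

apply : Unimodular → Point → Point
apply φ (x , y) =
  ( ι (a₁₁ φ) * x + ι (a₁₂ φ) * y + ι (w₁ φ)
  , ι (a₂₁ φ) * x + ι (a₂₂ φ) * y + ι (w₂ φ) )

Image⊆ : Unimodular → Region → Region → Set
Image⊆ φ Δ Q = ∀ p → Δ p → Q (apply φ p)

dSimplex : ℕ → Region
dSimplex d (x , y) = (0ℚ ≤ x) × (0ℚ ≤ y) × (x + y ≤ ι (+ d))

Rect : ℕ → ℕ → Region
Rect a b (x , y) =
  (0ℚ ≤ x) × (x ≤ ι (+ a)) × (0ℚ ≤ y) × (y ≤ ι (+ b))

FitsIn : Region → ℕ → Set
FitsIn Δ d = ∃ λ (φ : Unimodular) → Image⊆ φ Δ (dSimplex d)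

ls≡ : Region → ℕ → Set
ls≡ Δ n = FitsIn Δ n × (∀ d → FitsIn Δ d → n Data.Nat.≤ d)

module Submission where

-- Upper bound: the identity map already sends [0,a] × [0,b] into (a+b)Σ,
-- since x ≤ a and y ≤ b give x + y ≤ a + b.
--
-- Lower bound: let φ(v) = Av + w send the rectangle into dΣ.  The three
-- integral affine functionals  ℓ₁ = first coordinate of φ,  ℓ₂ = second
-- coordinate of φ  and  ℓ₁ + ℓ₂  take values in [0,d] on dΣ, hence at the
-- four (lattice) corners of the rectangle.  Since det A = ±1 ≠ 0, one of
-- them has both linear coefficients nonzero (nonzero-row).  For an integral
-- functional αx + βy + c with α, β ≠ 0, two opposite corners differ in value
-- by |α|a + |β|b ≥ a + b; both values lie in [0,d], so a + b ≤ d
-- (corner-spread).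

open import Defs
open import Data.Nat using (ℕ; _+_)

open import Data.Nat as ℕ using (suc; z≤n)
import Data.Nat.Properties as ℕP
open import Data.Integer as ℤ using (ℤ; +_; -[1+_]; +[1+_]; +≤+)
import Data.Integer.Properties as ℤP
open import Data.Integer.Tactic.RingSolver using (solve-∀)
open import Data.Rational as ℚ using (ℚ; toℚᵘ; 0ℚ)
import Data.Rational.Properties as ℚP
open import Data.Rational.Unnormalised as ℚᵘ using (mkℚᵘ; *≡*; *≤*)
import Data.Rational.Unnormalised.Properties as ℚᵘP
open import Data.Product using (_×_; _,_; proj₁; proj₂)
open import Data.Sum using (_⊎_; inj₁; inj₂)
open import Data.Empty using (⊥-elim)
open import Relation.Nullary using (yes; no)
open import Relation.Binary.PropositionalEquality

ι-unnormalised : ∀ z → toℚᵘ (ι z) ℚᵘ.≃ mkℚᵘ z 0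
ι-unnormalised z = ℚP.toℚᵘ-fromℚᵘ (mkℚᵘ z 0)

ι-+ : ∀ x y → ι (x ℤ.+ y) ≡ ι x ℚ.+ ι y
ι-+ x y = ℚP.toℚᵘ-injective (begin
  toℚᵘ (ι (x ℤ.+ y))                  ≈⟨ ι-unnormalised (x ℤ.+ y) ⟩
  mkℚᵘ (x ℤ.+ y) 0                    ≈⟨ *≡* (expand x y) ⟩
  mkℚᵘ x 0 ℚᵘ.+ mkℚᵘ y 0              ≈⟨ ℚᵘP.+-cong (ℚᵘP.≃-sym (ι-unnormalised x)) (ℚᵘP.≃-sym (ι-unnormalised y)) ⟩
  toℚᵘ (ι x) ℚᵘ.+ toℚᵘ (ι y)          ≈⟨ ℚᵘP.≃-sym (ℚP.toℚᵘ-homo-+ (ι x) (ι y)) ⟩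
  toℚᵘ (ι x ℚ.+ ι y)                  ∎)
  where
  open ℚᵘP.≃-Reasoning
  expand : ∀ x y → (x ℤ.+ y) ℤ.* + 1 ≡ (x ℤ.* + 1 ℤ.+ y ℤ.* + 1) ℤ.* + 1
  expand = solve-∀

ι-* : ∀ x y → ι (x ℤ.* y) ≡ ι x ℚ.* ι y
ι-* x y = ℚP.toℚᵘ-injective (begin
  toℚᵘ (ι (x ℤ.* y))                  ≈⟨ ι-unnormalised (x ℤ.* y) ⟩
  mkℚᵘ (x ℤ.* y) 0                    ≈⟨ *≡* refl ⟩
  mkℚᵘ x 0 ℚᵘ.* mkℚᵘ y 0              ≈⟨ ℚᵘP.*-cong (ℚᵘP.≃-sym (ι-unnormalised x)) (ℚᵘP.≃-sym (ι-unnormalised y)) ⟩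
  toℚᵘ (ι x) ℚᵘ.* toℚᵘ (ι y)          ≈⟨ ℚᵘP.≃-sym (ℚP.toℚᵘ-homo-* (ι x) (ι y)) ⟩
  toℚᵘ (ι x ℚ.* ι y)                  ∎)
  where open ℚᵘP.≃-Reasoning

ι-mono-≤ : ∀ {x y} → x ℤ.≤ y → ι x ℚ.≤ ι y
ι-mono-≤ {x} {y} x≤y = ℚP.toℚᵘ-cancel-≤
  (ℚᵘP.≤-respʳ-≃ (ℚᵘP.≃-sym (ι-unnormalised y)) (ℚᵘP.≤-respˡ-≃ (ℚᵘP.≃-sym (ι-unnormalised x))
    (*≤* (subst₂ ℤ._≤_ (sym (ℤP.*-identityʳ x)) (sym (ℤP.*-identityʳ y)) x≤y))))

ι-cancel-≤ : ∀ {x y} → ι x ℚ.≤ ι y → x ℤ.≤ y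
ι-cancel-≤ {x} {y} ιx≤ιy
  with ℚᵘP.≤-respʳ-≃ (ι-unnormalised y) (ℚᵘP.≤-respˡ-≃ (ι-unnormalised x) (ℚP.toℚᵘ-mono-≤ ιx≤ιy))
... | *≤* x*1≤y*1 = subst₂ ℤ._≤_ (ℤP.*-identityʳ x) (ℤP.*-identityʳ y) x*1≤y*1

identity : Unimodular
identity = record { a₁₁ = + 1 ; a₁₂ = + 0 ; a₂₁ = + 0 ; a₂₂ = + 1 ; w₁ = + 0 ; w₂ = + 0 ; det±1 = inj₁ refl }

apply-identity : ∀ p → apply identity p ≡ p
apply-identity (x , y) = cong₂ _,_ first second
  where
  first : ι (+ 1) ℚ.* x ℚ.+ ι (+ 0) ℚ.* y ℚ.+ ι (+ 0) ≡ x
  first rewrite ℚP.*-identityˡ x | ℚP.*-zeroˡ y | ℚP.+-identityʳ x | ℚP.+-identityʳ x = refl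
  second : ι (+ 0) ℚ.* x ℚ.+ ι (+ 1) ℚ.* y ℚ.+ ι (+ 0) ≡ y
  second rewrite ℚP.*-identityˡ y | ℚP.*-zeroˡ x | ℚP.+-identityˡ y | ℚP.+-identityʳ y = refl

rect-fits : ∀ a b → FitsIn (Rect a b) (a + b)
rect-fits a b = identity , λ { (x , y) (0≤x , x≤a , 0≤y , y≤b) →
  subst (dSimplex (a + b)) (sym (apply-identity (x , y)))
    (0≤x , 0≤y , subst (x ℚ.+ y ℚ.≤_) (sym (ι-+ (+ a) (+ b))) (ℚP.+-mono-≤ x≤a y≤b)) }

affine : ℤ → ℤ → ℤ → ℤ → ℤ → ℤ
affine α β c x y = α ℤ.* x ℤ.+ β ℤ.* y ℤ.+ c

InRange : ℕ → ℤ → Set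
InRange d z = (+ 0 ℤ.≤ z) × (z ℤ.≤ + d)

record AtCorners (P : ℤ → ℤ → Set) (a b : ℕ) : Set where
  constructor corners
  field
    at₀₀ : P (+ 0) (+ 0)
    atₐ₀ : P (+ a) (+ 0)
    at₀ᵦ : P (+ 0) (+ b)
    atₐᵦ : P (+ a) (+ b)

mapCorners : ∀ {P Q : ℤ → ℤ → Set} {a b} → (∀ x y → P x y → Q x y) → AtCorners P a b → AtCorners Q a b
mapCorners f (corners p₀₀ pₐ₀ p₀ᵦ pₐᵦ) = corners (f _ _ p₀₀) (f _ _ pₐ₀) (f _ _ p₀ᵦ) (f _ _ pₐᵦ)

affine-difference : ∀ α β c x y x′ y′ →
  affine α β c x y ≡ affine α β c x′ y′ ℤ.+ (α ℤ.* (x ℤ.- x′) ℤ.+ β ℤ.* (y ℤ.- y′))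
affine-difference = expand
  where
  expand : ∀ α β c x y x′ y′ →
    α ℤ.* x ℤ.+ β ℤ.* y ℤ.+ c ≡ (α ℤ.* x′ ℤ.+ β ℤ.* y′ ℤ.+ c) ℤ.+ (α ℤ.* (x ℤ.- x′) ℤ.+ β ℤ.* (y ℤ.- y′))
  expand = solve-∀

gap-bound : ∀ {lo hi D : ℤ} {d : ℕ} (n : ℕ) → + 0 ℤ.≤ lo → hi ℤ.≤ + d →
            hi ≡ lo ℤ.+ D → + n ℤ.≤ D → n ℕ.≤ d
gap-bound {lo} {hi} {D} {d} n 0≤lo hi≤d hi≡lo+D n≤D = ℤP.drop‿+≤+ (begin
  + n         ≤⟨ n≤D ⟩
  D           ≡⟨ ℤP.+-identityˡ D ⟨
  + 0 ℤ.+ D   ≤⟨ ℤP.+-monoˡ-≤ D 0≤lo ⟩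
  lo ℤ.+ D    ≡⟨ hi≡lo+D ⟨
  hi          ≤⟨ hi≤d ⟩
  + d         ∎)
  where open ℤP.≤-Reasoning

stretch : ∀ m a → + a ℤ.≤ +[1+ m ] ℤ.* + a
stretch m a rewrite ℤP.+◃n≡+n (suc m ℕ.* a) = +≤+ (ℕP.m≤n*m a (suc m))

positive-stretch : ∀ m a → + a ℤ.≤ +[1+ m ] ℤ.* (+ a ℤ.- + 0)
positive-stretch m a = subst (λ t → + a ℤ.≤ +[1+ m ] ℤ.* t) (sym (ℤP.+-identityʳ (+ a))) (stretch m a)

negative-stretch : ∀ m a → + a ℤ.≤ -[1+ m ] ℤ.* (+ 0 ℤ.- + a)
negative-stretch m a
  rewrite ℤP.+-identityˡ (ℤ.- + a) | sym (ℤP.neg-distribʳ-* -[1+ m ] (+ a)) | ℤP.neg-distribˡ-* -[1+ m ] (+ a)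
  = stretch m a

-- An integral affine functional with both linear coefficients nonzero that
-- maps the corners of [0,a] × [0,b] into [0,d] forces a + b ≤ d: at the two
-- opposite corners chosen according to the signs of α and β its values
-- differ by |α| a + |β| b ≥ a + b.
corner-spread : ∀ {d a b} α β c → α ≢ + 0 → β ≢ + 0 →
                AtCorners (λ x y → InRange d (affine α β c x y)) a b → a + b ℕ.≤ d
corner-spread (+ 0) β c α≢0 β≢0 _ = ⊥-elim (α≢0 refl)
corner-spread α (+ 0) c α≢0 β≢0 _ = ⊥-elim (β≢0 refl)
corner-spread {a = a} {b = b} α@(+[1+ m ]) β@(+[1+ n ]) c _ _ (corners f₀₀ fₐ₀ f₀ᵦ fₐᵦ) =
  gap-bound (a + b) (proj₁ f₀₀) (proj₂ fₐᵦ) (affine-difference α β c (+ a) (+ b) (+ 0) (+ 0))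
    (ℤP.+-mono-≤ (positive-stretch m a) (positive-stretch n b))
corner-spread {a = a} {b = b} α@(+[1+ m ]) β@(-[1+ n ]) c _ _ (corners f₀₀ fₐ₀ f₀ᵦ fₐᵦ) =
  gap-bound (a + b) (proj₁ f₀ᵦ) (proj₂ fₐ₀) (affine-difference α β c (+ a) (+ 0) (+ 0) (+ b))
    (ℤP.+-mono-≤ (positive-stretch m a) (negative-stretch n b))
corner-spread {a = a} {b = b} α@(-[1+ m ]) β@(+[1+ n ]) c _ _ (corners f₀₀ fₐ₀ f₀ᵦ fₐᵦ) =
  gap-bound (a + b) (proj₁ fₐ₀) (proj₂ f₀ᵦ) (affine-difference α β c (+ 0) (+ b) (+ a) (+ 0))
    (ℤP.+-mono-≤ (negative-stretch m a) (positive-stretch n b))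
corner-spread {a = a} {b = b} α@(-[1+ m ]) β@(-[1+ n ]) c _ _ (corners f₀₀ fₐ₀ f₀ᵦ fₐᵦ) =
  gap-bound (a + b) (proj₁ fₐᵦ) (proj₂ f₀₀) (affine-difference α β c (+ 0) (+ 0) (+ a) (+ b))
    (ℤP.+-mono-≤ (negative-stretch m a) (negative-stretch n b))

BothNonzero : ℤ → ℤ → Set
BothNonzero x y = (x ≢ + 0) × (y ≢ + 0)

nonzero-row : ∀ α₁ β₁ α₂ β₂ → α₁ ℤ.* β₂ ℤ.- β₁ ℤ.* α₂ ≢ + 0 →
              BothNonzero α₁ β₁ ⊎ BothNonzero α₂ β₂ ⊎ BothNonzero (α₁ ℤ.+ α₂) (β₁ ℤ.+ β₂)
nonzero-row α₁ β₁ α₂ β₂ det≢0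
  with α₁ ℤ.≟ + 0 | β₁ ℤ.≟ + 0 | α₂ ℤ.≟ + 0 | β₂ ℤ.≟ + 0
... | no α₁≢0 | no β₁≢0 | _ | _ = inj₁ (α₁≢0 , β₁≢0)
... | _ | _ | no α₂≢0 | no β₂≢0 = inj₂ (inj₁ (α₂≢0 , β₂≢0))
... | yes refl | _ | yes refl | _ = ⊥-elim (det≢0 (zero-column β₁ β₂))
  where
  zero-column : ∀ β₁ β₂ → + 0 ℤ.* β₂ ℤ.- β₁ ℤ.* + 0 ≡ + 0
  zero-column = solve-∀
... | _ | yes refl | _ | yes refl = ⊥-elim (det≢0 (zero-column α₁ α₂))
  where
  zero-column : ∀ α₁ α₂ → α₁ ℤ.* + 0 ℤ.- + 0 ℤ.* α₂ ≡ + 0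
  zero-column = solve-∀
... | yes refl | no β₁≢0 | no α₂≢0 | yes refl
  rewrite ℤP.+-identityˡ α₂ | ℤP.+-identityʳ β₁ = inj₂ (inj₂ (α₂≢0 , β₁≢0))
... | no α₁≢0 | yes refl | yes refl | no β₂≢0
  rewrite ℤP.+-identityʳ α₁ | ℤP.+-identityˡ β₂ = inj₂ (inj₂ (α₁≢0 , β₂≢0))

±1-nonzero : ∀ {D : ℤ} → (D ≡ + 1) ⊎ (D ≡ -[1+ 0 ]) → D ≢ + 0
±1-nonzero (inj₁ refl) ()
±1-nonzero (inj₂ refl) ()

first-row second-row : Unimodular → ℤ → ℤ → ℤ
first-row φ = affine (a₁₁ φ) (a₁₂ φ) (w₁ φ)
second-row φ = affine (a₂₁ φ) (a₂₂ φ) (w₂ φ)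

ι-affine : ∀ α β c x y → ι α ℚ.* ι x ℚ.+ ι β ℚ.* ι y ℚ.+ ι c ≡ ι (affine α β c x y)
ι-affine α β c x y = sym (begin
  ι (α ℤ.* x ℤ.+ β ℤ.* y ℤ.+ c)           ≡⟨ ι-+ (α ℤ.* x ℤ.+ β ℤ.* y) c ⟩
  ι (α ℤ.* x ℤ.+ β ℤ.* y) ℚ.+ ι c         ≡⟨ cong (ℚ._+ ι c) (ι-+ (α ℤ.* x) (β ℤ.* y)) ⟩
  ι (α ℤ.* x) ℚ.+ ι (β ℤ.* y) ℚ.+ ι c     ≡⟨ cong₂ (λ u v → u ℚ.+ v ℚ.+ ι c) (ι-* α x) (ι-* β y) ⟩
  ι α ℚ.* ι x ℚ.+ ι β ℚ.* ι y ℚ.+ ι c     ∎)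
  where open ≡-Reasoning

apply-lattice : ∀ φ x y → apply φ (ι x , ι y) ≡ (ι (first-row φ x y) , ι (second-row φ x y))
apply-lattice φ x y = cong₂ _,_ (ι-affine (a₁₁ φ) (a₁₂ φ) (w₁ φ) x y) (ι-affine (a₂₁ φ) (a₂₂ φ) (w₂ φ) x y)

LatticeSimplex : ℕ → ℤ → ℤ → Set
LatticeSimplex d u v = (+ 0 ℤ.≤ u) × (+ 0 ℤ.≤ v) × (u ℤ.+ v ℤ.≤ + d)

lattice-simplex : ∀ {d u v} → dSimplex d (ι u , ι v) → LatticeSimplex d u v
lattice-simplex {d} {u} {v} (0≤u , 0≤v , u+v≤d) =
  ι-cancel-≤ 0≤u , ι-cancel-≤ 0≤v , ι-cancel-≤ (subst (ℚ._≤ ι (+ d)) (sym (ι-+ u v)) u+v≤d)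

first-in-range : ∀ {d u v} → LatticeSimplex d u v → InRange d u
first-in-range {d} {u} {v} (0≤u , 0≤v , u+v≤d) = 0≤u , ℤP.≤-trans (ℤP.i≤i+j u v {{ℤ.nonNegative 0≤v}}) u+v≤d

second-in-range : ∀ {d u v} → LatticeSimplex d u v → InRange d v
second-in-range {d} {u} {v} (0≤u , 0≤v , u+v≤d) = 0≤v , ℤP.≤-trans (ℤP.i≤j+i v u {{ℤ.nonNegative 0≤u}}) u+v≤d

sum-in-range : ∀ {d u v} → LatticeSimplex d u v → InRange d (u ℤ.+ v)
sum-in-range (0≤u , 0≤v , u+v≤d) = ℤP.+-mono-≤ 0≤u 0≤v , u+v≤d

affine-+ : ∀ α β c α′ β′ c′ x y →
           affine α β c x y ℤ.+ affine α′ β′ c′ x y ≡ affine (α ℤ.+ α′) (β ℤ.+ β′) (c ℤ.+ c′) x y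
affine-+ = expand
  where
  expand : ∀ α β c α′ β′ c′ x y →
    (α ℤ.* x ℤ.+ β ℤ.* y ℤ.+ c) ℤ.+ (α′ ℤ.* x ℤ.+ β′ ℤ.* y ℤ.+ c′) ≡ (α ℤ.+ α′) ℤ.* x ℤ.+ (β ℤ.+ β′) ℤ.* y ℤ.+ (c ℤ.+ c′)
  expand = solve-∀

Between : ℕ → ℚ → Set
Between n x = (0ℚ ℚ.≤ x) × (x ℚ.≤ ι (+ n))

zero-between : ∀ n → Between n (ι (+ 0))
zero-between n = ℚP.≤-refl , ι-mono-≤ {+ 0} {+ n} (+≤+ z≤n)

end-between : ∀ n → Between n (ι (+ n))
end-between n = ι-mono-≤ {+ 0} {+ n} (+≤+ z≤n) , ℚP.≤-refl

rect-point : ∀ a b {x y} → Between a x → Between b y → Rect a b (x , y)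
rect-point a b (0≤x , x≤a) (0≤y , y≤b) = 0≤x , x≤a , 0≤y , y≤b

rect-corners : ∀ a b → AtCorners (λ x y → Rect a b (ι x , ι y)) a b
rect-corners a b = corners
  (rect-point a b (zero-between a) (zero-between b)) (rect-point a b (end-between a) (zero-between b))
  (rect-point a b (zero-between a) (end-between b)) (rect-point a b (end-between a) (end-between b))

corners-in-simplex : ∀ {a b d} φ → Image⊆ φ (Rect a b) (dSimplex d) →
                     AtCorners (λ x y → LatticeSimplex d (first-row φ x y) (second-row φ x y)) a b
corners-in-simplex {a} {b} {d} φ φΔ⊆dΣ = mapCorners image-in-simplex (rect-corners a b)
  where
  image-in-simplex : ∀ x y → Rect a b (ι x , ι y) → LatticeSimplex d (first-row φ x y) (second-row φ x y)
  image-in-simplex x y p = lattice-simplex (subst (dSimplex d) (apply-lattice φ x y) (φΔ⊆dΣ _ p))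

rect-lower-bound : ∀ a b d → FitsIn (Rect a b) d → a + b ℕ.≤ d
rect-lower-bound a b d (φ , φΔ⊆dΣ) =
  from-nonzero-row (nonzero-row (a₁₁ φ) (a₁₂ φ) (a₂₁ φ) (a₂₂ φ) (±1-nonzero (det±1 φ)))
  where
  lattice-corners : AtCorners (λ x y → LatticeSimplex d (first-row φ x y) (second-row φ x y)) a b
  lattice-corners = corners-in-simplex {a} {b} {d} φ φΔ⊆dΣ

  sum-row-in-range : ∀ x y → LatticeSimplex d (first-row φ x y) (second-row φ x y) →
    InRange d (affine (a₁₁ φ ℤ.+ a₂₁ φ) (a₁₂ φ ℤ.+ a₂₂ φ) (w₁ φ ℤ.+ w₂ φ) x y)
  sum-row-in-range x y p =
    subst (InRange d) (affine-+ (a₁₁ φ) (a₁₂ φ) (w₁ φ) (a₂₁ φ) (a₂₂ φ) (w₂ φ) x y) (sum-in-range p)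

  from-nonzero-row : BothNonzero (a₁₁ φ) (a₁₂ φ) ⊎ BothNonzero (a₂₁ φ) (a₂₂ φ)
                       ⊎ BothNonzero (a₁₁ φ ℤ.+ a₂₁ φ) (a₁₂ φ ℤ.+ a₂₂ φ) → a + b ℕ.≤ d
  from-nonzero-row (inj₁ (α≢0 , β≢0)) = corner-spread (a₁₁ φ) (a₁₂ φ) (w₁ φ) α≢0 β≢0
    (mapCorners (λ _ _ → first-in-range) lattice-corners)
  from-nonzero-row (inj₂ (inj₁ (α≢0 , β≢0))) = corner-spread (a₂₁ φ) (a₂₂ φ) (w₂ φ) α≢0 β≢0
    (mapCorners (λ _ _ → second-in-range) lattice-corners)
  from-nonzero-row (inj₂ (inj₂ (α≢0 , β≢0))) = corner-spread (a₁₁ φ ℤ.+ a₂₁ φ) (a₁₂ φ ℤ.+ a₂₂ φ) (w₁ φ ℤ.+ w₂ φ) α≢0 β≢0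
    (mapCorners sum-row-in-range lattice-corners)

lemma4 : (a b : ℕ) → ls≡ (Rect a b) (a + b)
lemma4 a b = rect-fits a b , rect-lower-bound a b
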